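{- Let $n \geq 1$ and $\Pi \subseteq S_n$. For $m > n$ let $G_m = G_m(\Pi)$, let $d_m = |\Pi| + (m - n)$ be its out-degree and $D_m$ its directed diameter, and let $M(d, D) = 1 + d + d^2 + \dots + d^D$ denote the directed Moore bound. Then $$\lim_{m \to \infty} \frac{|V(G_m)|}{M(d_m, D_m)} = 1$$ if and only if the eventual diameter of $\Pi$ equals $n$.
   Context: Word graphs: for $\Pi \subseteq S_n$, $m > n$ and a set $B$ with $|B| = m$, the word graph $G_m = G_m(\Pi)$ is the directed graph whose vertices are the words $x_1 \dots x_n$ over $B$ with pairwise distinct letters, with arcs $x_1 x_2 \dots x_n \to x_2 \dots x_n y$ for every $y \in B\setminus\{x_1,\dots,x_n\}$ and $x_1 \dots x_n \to x_{\pi(1)} \dots x_{\pi(n)}$ for every $\pi \in \Pi$. The eventual diameter of $\Pi$ is the directed diameter of $G_{4n}(\Pi)$. -}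

module Defs where

open import Data.Nat using (ℕ; zero; suc; _+_; _*_; _∸_; _^_; _≤_)
open import Data.Nat.Combinatorics using (_P_)
open import Data.Fin using (Fin)
open import Data.Vec using (Vec; []; _∷_; _∷ʳ_; lookup; map)
import Data.Vec.Membership.Propositional as VecMem
import Data.List.Membership.Propositional as ListMem
open import Data.List using (List; length)
open import Data.Integer using (+_)
open import Data.Rational using (ℚ; _/_; _-_; ∣_∣; 1ℚ)
open import Data.Product using (_×_)
open import Relation.Binary.PropositionalEquality using (_≡_)
open import Relation.Nullary using (¬_)

Distinct : ∀ {m n} → Vec (Fin m) n → Set
Distinct {n = n} v = ∀ (i j : Fin n) → lookup v i ≡ lookup v j → i ≡ j

-- A permutation of [n] in one-line notation: π = π(1) … π(n), injective
-- (equivalently bijective, since Fin n is finite).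
IsPerm : ∀ {n} → Vec (Fin n) n → Set
IsPerm = Distinct

shift : ∀ {A : Set} {n} → Vec A n → A → Vec A n
shift []       y = []
shift (x ∷ xs) y = xs ∷ʳ y

data Arc {m n : ℕ} (Π : List (Vec (Fin n) n)) (u : Vec (Fin m) n) : Vec (Fin m) n → Set where
  shiftArc : (y : Fin m) → ¬ (y VecMem.∈ u) → Arc Π u (shift u y)
  permArc  : (π : Vec (Fin n) n) → π ListMem.∈ Π → Arc Π u (map (lookup u) π)

data Walk≤ {m n : ℕ} (Π : List (Vec (Fin n) n)) : ℕ → Vec (Fin m) n → Vec (Fin m) n → Set where
  here  : ∀ {k u} → Walk≤ Π k u u
  step  : ∀ {k u w v} → Arc Π u w → Walk≤ Π k w v → Walk≤ Π (suc k) u v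

AllWithin : ∀ {n} → List (Vec (Fin n) n) → (m D : ℕ) → Set
AllWithin {n} Π m D =
  ∀ (u v : Vec (Fin m) n) → Distinct u → Distinct v → Walk≤ Π D u v

-- D is the (finite) directed diameter of G_m(Π).
-- (If G_m is not strongly connected no such D exists: diameter ∞.)
IsDiameter : ∀ {n} → List (Vec (Fin n) n) → (m D : ℕ) → Set
IsDiameter Π m D = AllWithin Π m D × (∀ D′ → AllWithin Π m D′ → D ≤ D′)

moorePred : ℕ → ℕ → ℕ
moorePred d zero    = 0
moorePred d (suc D) = moorePred d D + d ^ suc D

Moore : ℕ → ℕ → ℕ
Moore d D = suc (moorePred d D)

-- |V(G_m)| = number of words of length n over m letters with distinct letters
numVertices : ℕ → ℕ → ℕ
numVertices m n = m P n

outDeg : ∀ {n} → List (Vec (Fin n) n) → ℕ → ℕ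
outDeg {n} Π m = length Π + (m ∸ n)

ratio : ∀ {n} → List (Vec (Fin n) n) → (m D : ℕ) → ℚ
ratio {n} Π m D = (+ numVertices m n) / suc (moorePred (outDeg Π m) D)

module Submission where

-- |V(G_m)| / M(d_m, D_m) → 1 as m → ∞ exactly when the diameter D_{4n} of G_{4n} is n.
-- Throughout, x = m − n, so that d_m = |Π| + x and |V(G_m)| = m P n.
--
-- Combinatorics of the word graphs; it holds for any list Π of index vectors, so the
-- hypotheses that Π consists of distinct permutations are not needed.
--   * Lower bound: an arc adds at most one letter of the target word, so two words with
--     disjoint letters are at distance ≥ n; every diameter of G_m (m ≥ 2n) is ≥ n.
--   * Transfer: a walk of length ≤ k only involves the 2n letters of its ends and the ≤ k
--     letters it inserts, so "all distances ≤ k" passes from any alphabet of size ≥ 2n to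
--     any alphabet of size ≥ 2n + k.  With k = n: for m, m′ ≥ 3n, D_m = n iff D_{m′} = n.
-- Arithmetic.
--   * If D = n, both m P n and M(d_m, n) lie between x^n and (x + n + |Π| + 1)^n, whose
--     ratio tends to 1 by a Bernoulli-type inequality.
--   * If D > n, M(d_m, D) ≥ x^(n+1) exceeds 2 · m P n for large x: the ratio stays ≤ 1/2.
-- The theorem follows: if D_{4n} = n then D_m = n for large m and the ratio tends to 1;
-- conversely the ratio being eventually within 1/2 of 1 forces D_m ≤ n for some large m,
-- and transfer brings this back to 4n.

open import Defs

open import Data.Bool using (true)
open import Data.Empty using (⊥-elim)
open import Data.Fin as F using (Fin; toℕ; fromℕ<)
open import Data.Fin.Permutation using (Permutation′; _⟨$⟩ʳ_; _⟨$⟩ˡ_; inverseˡ; transpose; _∘ₚ_; flip)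
  renaming (id to idₚ)
open import Data.Fin.Properties using (toℕ-injective; toℕ<n; toℕ-fromℕ<)
  renaming (_≟_ to _≟ᶠ_; 0≢1+n to zero≢suc; suc-injective to suc-injectiveᶠ)
open import Data.Integer as ℤ using (-[1+_]; +[1+_]; _⊖_)
import Data.Integer.Properties as ℤ
open import Data.List using (List; []; _∷_; length)
open import Data.List.Membership.Propositional using () renaming (_∈_ to _∈ₗ_)
import Data.List.Relation.Unary.Any as ListAny
open import Data.List.Relation.Unary.All using (All)
open import Data.List.Relation.Unary.Unique.Propositional using (Unique)
open import Data.Nat using (ℕ; zero; suc; _+_; _*_; _∸_; _^_; _≤_; _<_; z≤n; s≤s; _≤?_; _<?_; _≤ᵇ_; NonZero; >-nonZero)
  renaming (∣_-_∣ to dist)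
open import Data.Nat.Combinatorics using (_P_)
open import Data.Nat.Combinatorics.Base using (_P′_)
open import Data.Nat.Properties
open import Algebra.Properties.CommutativeMonoid.Sum +-0-commutativeMonoid using (sum; ∑-distrib-+)
open import Data.Nat.Solver using (module +-*-Solver)
open +-*-Solver using (solve; _:+_; _:*_; _:=_; con)
open import Data.Product using (∃-syntax; _×_; _,_; proj₁; proj₂)
open import Data.Rational using (ℚ; mkℚ; 0ℚ; 1ℚ; _-_; ∣_∣; _/_; ↥_; ↧ₙ_; ½; toℚᵘ) renaming (_<_ to _<ℚ_)
import Data.Rational as ℚ
open import Data.Rational.Properties using (toℚᵘ-homo-∣-∣; toℚᵘ-homo-+; toℚᵘ-homo‿-; toℚᵘ-fromℚᵘ; toℚᵘ-mono-<; toℚᵘ-cancel-<; positive⁻¹)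
open import Data.Rational.Unnormalised as ℚᵘ using (mkℚᵘ; _≃_; *≡*; *<*)
import Data.Rational.Unnormalised.Properties as ℚᵘ
open import Data.Sum using (_⊎_; inj₁; inj₂; map₁)
open import Data.Vec using (Vec; []; _∷_; _∷ʳ_; _++_; lookup; map; tabulate; toList)
open import Data.Vec.Properties using (lookup-map; map-∷ʳ; map-∘; map-cong; lookup∘tabulate; length-toList)
import Data.Vec.Membership.DecPropositional as DecMembership
open import Data.Vec.Membership.Propositional using (_∈_)
open import Data.Vec.Membership.Propositional.Properties using (∈-lookup; ∈-toList⁺; ∈-++⁺ˡ; ∈-++⁺ʳ)
open import Data.Vec.Relation.Unary.Any as VecAny using (here; there)
open import Data.Vec.Relation.Unary.Any.Properties using (lookup-index)
open import Function using (_∘_; case_of_)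
open import Function.Bundles using (Injection; _⇔_; mk⇔)
open import Function.Properties.Inverse using (↔⇒↣)
open import Relation.Binary.PropositionalEquality
open import Relation.Nullary using (¬_; Dec; yes; no)
open import Relation.Nullary.Decidable using (dec-true; dec-false)

private
  variable
    m m′ n k k′ D K : ℕ

∈-∷ʳ⁻ : ∀ {A : Set} {x y : A} (xs : Vec A n) → x ∈ xs ∷ʳ y → x ∈ xs ⊎ x ≡ y
∈-∷ʳ⁻ []       (here x≡y) = inj₂ x≡y
∈-∷ʳ⁻ (z ∷ zs) (here x≡z) = inj₁ (here x≡z)
∈-∷ʳ⁻ (z ∷ zs) (there p)  = map₁ there (∈-∷ʳ⁻ zs p)

∈-shift⁻ : ∀ {A : Set} {x y : A} (u : Vec A n) → x ∈ shift u y → x ∈ u ⊎ x ≡ y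
∈-shift⁻ (z ∷ zs) p = map₁ there (∈-∷ʳ⁻ zs p)

∈-map⁻ : ∀ {A B : Set} {x : B} (f : A → B) (xs : Vec A n) → x ∈ map f xs → ∃[ a ] a ∈ xs × x ≡ f a
∈-map⁻ f (z ∷ zs) (here x≡fz) = z , here refl , x≡fz
∈-map⁻ f (z ∷ zs) (there p) with ∈-map⁻ f zs p
... | a , a∈zs , x≡fa = a , there a∈zs , x≡fa

∈-permute⁻ : ∀ {A : Set} {x : A} (u : Vec A n) (π : Vec (Fin n) n) → x ∈ map (lookup u) π → x ∈ u
∈-permute⁻ u π p with ∈-map⁻ (lookup u) π p
... | i , _ , refl = ∈-lookup i u

map-shift : ∀ {A B : Set} (f : A → B) (u : Vec A n) (y : A) → map f (shift u y) ≡ shift (map f u) (f y)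
map-shift f []       y = refl
map-shift f (z ∷ zs) y = map-∷ʳ f y zs

map-permute : ∀ {A B : Set} (f : A → B) (u : Vec A n) (π : Vec (Fin n) n) →
  map f (map (lookup u) π) ≡ map (lookup (map f u)) π
map-permute f u π = trans (sym (map-∘ f (lookup u) π)) (map-cong (λ i → sym (lookup-map i f u)) π)

walk-weaken : ∀ {Π : List (Vec (Fin n) n)} {u v : Vec (Fin m) n} → k ≤ k′ → Walk≤ Π k u v → Walk≤ Π k′ u v
walk-weaken _         here       = here
walk-weaken (s≤s k≤k′) (step a W) = step a (walk-weaken k≤k′ W)

inserted : ∀ {Π : List (Vec (Fin n) n)} {u v : Vec (Fin m) n} → Walk≤ Π k u v → List (Fin m)
inserted here                    = []
inserted (step (shiftArc y _) W) = y ∷ inserted W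
inserted (step (permArc _ _) W)  = inserted W

inserted-length : ∀ {Π : List (Vec (Fin n) n)} {u v : Vec (Fin m) n} (W : Walk≤ Π k u v) → length (inserted W) ≤ k
inserted-length here                    = z≤n
inserted-length (step (shiftArc _ _) W) = s≤s (inserted-length W)
inserted-length (step (permArc _ _) W)  = m≤n⇒m≤1+n (inserted-length W)

-- Renaming the letters of a walk by f gives a walk, provided f is injective on the
-- letters it ever meets (those of the start word and the inserted ones): injectivity keeps
-- each inserted letter fresh.
module _ (Π : List (Vec (Fin n) n)) (f : Fin m → Fin m′) (P : Fin m → Set)
         (f-inj : ∀ {x y} → P x → P y → f x ≡ f y → x ≡ y) where

  relabel : ∀ {u v} (W : Walk≤ Π k u v) → (∀ {x} → x ∈ u → P x) → (∀ {y} → y ∈ₗ inserted W → P y) →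
    Walk≤ Π k (map f u) (map f v)
  relabel here _ _ = here
  relabel {u = u} (step (shiftArc y y∉u) W) P-u P-ins =
    step (subst (Arc Π (map f u)) (sym (map-shift f u y)) (shiftArc (f y) fy∉fu))
         (relabel W P-shift (P-ins ∘ ListAny.there))
    where
    P-y : P y
    P-y = P-ins (ListAny.here refl)
    fy∉fu : ¬ (f y ∈ map f u)
    fy∉fu p with ∈-map⁻ f u p
    ... | a , a∈u , fy≡fa with f-inj P-y (P-u a∈u) fy≡fa
    ...   | refl = y∉u a∈u
    P-shift : ∀ {x} → x ∈ shift u y → P x
    P-shift p with ∈-shift⁻ u p
    ... | inj₁ x∈u  = P-u x∈u
    ... | inj₂ refl = P-y
  relabel {u = u} (step (permArc π π∈Π) W) P-u P-ins =
    step (subst (Arc Π (map f u)) (sym (map-permute f u π)) (permArc π π∈Π))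
         (relabel W (P-u ∘ ∈-permute⁻ u π) P-ins)

indicator : ∀ {P : Set} → Dec P → ℕ
indicator (yes _) = 1
indicator (no _)  = 0

indicator-yes : ∀ {P : Set} (d : Dec P) → P → indicator d ≡ 1
indicator-yes (yes _) _ = refl
indicator-yes (no ¬p) p = ⊥-elim (¬p p)

indicator-no : ∀ {P : Set} (d : Dec P) → ¬ P → indicator d ≡ 0
indicator-no (yes p) ¬p = ⊥-elim (¬p p)
indicator-no (no _)  _  = refl

sum-mono : (f g : Fin n → ℕ) → (∀ i → f i ≤ g i) → sum f ≤ sum g
sum-mono {zero}  f g f≤g = z≤n
sum-mono {suc n} f g f≤g = +-mono-≤ (f≤g F.zero) (sum-mono (f ∘ F.suc) (g ∘ F.suc) (f≤g ∘ F.suc))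

sum-const : (f : Fin n → ℕ) (c : ℕ) → (∀ i → f i ≡ c) → sum f ≡ n * c
sum-const {zero}  f c f≡c = refl
sum-const {suc n} f c f≡c = cong₂ _+_ (f≡c F.zero) (sum-const (f ∘ F.suc) c (f≡c ∘ F.suc))

hits≤1 : (g : Fin n → Fin m) → (∀ i j → g i ≡ g j → i ≡ j) → ∀ y → sum (λ i → indicator (g i ≟ᶠ y)) ≤ 1
hits≤1 {zero}  g g-inj y = z≤n
hits≤1 {suc n} g g-inj y with g F.zero ≟ᶠ y
... | yes g0≡y = ≤-reflexive (cong suc (trans (sum-const _ 0 no-later-hit) (*-zeroʳ n)))
  where
  no-later-hit : ∀ i → indicator (g (F.suc i) ≟ᶠ y) ≡ 0
  no-later-hit i = indicator-no _ (λ gi≡y → zero≢suc (g-inj _ _ (trans g0≡y (sym gi≡y))))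
... | no _ = hits≤1 (g ∘ F.suc) (λ i j gi≡gj → suc-injectiveᶠ (g-inj _ _ gi≡gj)) y

-- Fix a target word v. `present w` counts the letters of v occurring in w; an arc raises
-- it by at most one, so reaching v (present = n) from a word disjoint from v (present = 0)
-- takes at least n arcs.
module Presence (Π : List (Vec (Fin n) n)) (v : Vec (Fin m) n) (v-distinct : Distinct v) where

  _∈?_ : ∀ x (w : Vec (Fin m) n) → Dec (x ∈ w)
  x ∈? w = DecMembership._∈?_ _≟ᶠ_ x w

  occurs : Fin m → Vec (Fin m) n → ℕ
  occurs x w = indicator (x ∈? w)

  present : Vec (Fin m) n → ℕ
  present w = sum (λ i → occurs (lookup v i) w)

  occurs-mono : ∀ x w w′ → (x ∈ w′ → x ∈ w) → occurs x w′ ≤ occurs x w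
  occurs-mono x w w′ w′⊆w with x ∈? w′
  ... | no _       = z≤n
  ... | yes x∈w′ = ≤-reflexive (sym (indicator-yes _ (w′⊆w x∈w′)))

  occurs-shift : ∀ x w y → occurs x (shift w y) ≤ occurs x w + indicator (x ≟ᶠ y)
  occurs-shift x w y with x ∈? shift w y
  ... | no _ = z≤n
  ... | yes x∈shift with ∈-shift⁻ w x∈shift
  ...   | inj₁ x∈w = ≤-trans (≤-reflexive (sym (indicator-yes (x ∈? w) x∈w))) (m≤m+n _ _)
  ...   | inj₂ x≡y = ≤-trans (≤-reflexive (sym (indicator-yes (x ≟ᶠ y) x≡y))) (m≤n+m _ (occurs x w))

  present-arc : ∀ {w w′} → Arc Π w w′ → present w′ ≤ present w + 1
  present-arc {w} (shiftArc y _) = begin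
    present (shift w y)                                          ≤⟨ sum-mono _ _ (λ i → occurs-shift (lookup v i) w y) ⟩
    sum (λ i → occurs (lookup v i) w + indicator (lookup v i ≟ᶠ y)) ≡⟨ ∑-distrib-+ (λ i → occurs (lookup v i) w) (λ i → indicator (lookup v i ≟ᶠ y)) ⟩
    present w + sum (λ i → indicator (lookup v i ≟ᶠ y))           ≤⟨ +-monoʳ-≤ (present w) (hits≤1 (lookup v) v-distinct y) ⟩
    present w + 1                                                ∎
    where open ≤-Reasoning
  present-arc {w} (permArc π _) =
    ≤-trans (sum-mono _ _ (λ i → occurs-mono (lookup v i) w _ (∈-permute⁻ w π))) (m≤m+n (present w) 1)

  present-walk : ∀ {w w′} → Walk≤ Π k w w′ → present w′ ≤ present w + k
  present-walk here = m≤m+n _ _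
  present-walk {suc k} {w} (step {w = w₁} a W) = begin
    _                     ≤⟨ present-walk W ⟩
    present w₁ + k        ≤⟨ +-monoˡ-≤ k (present-arc a) ⟩
    present w + 1 + k     ≡⟨ +-assoc (present w) 1 k ⟩
    present w + suc k     ∎
    where open ≤-Reasoning

  walk-length-lower-bound : ∀ u → (∀ i → ¬ (lookup v i ∈ u)) → Walk≤ Π k u v → n ≤ k
  walk-length-lower-bound {k} u disjoint W = begin
    n                   ≡⟨ sym (*-identityʳ n) ⟩
    n * 1               ≡⟨ sym (sum-const _ 1 (λ i → indicator-yes _ (∈-lookup i v))) ⟩
    present v           ≤⟨ present-walk W ⟩
    present u + k       ≡⟨ cong (_+ k) (trans (sum-const _ 0 (λ i → indicator-no _ (disjoint i))) (*-zeroʳ n)) ⟩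
    k                   ∎
    where open ≤-Reasoning

interval : (o : ℕ) → o + n ≤ m → Vec (Fin m) n
interval o le = tabulate (λ i → fromℕ< (≤-trans (+-monoʳ-< o (toℕ<n i)) le))

interval-value : ∀ o (le : o + n ≤ m) i → toℕ (lookup (interval o le) i) ≡ o + toℕ i
interval-value o le i = trans (cong toℕ (lookup∘tabulate _ i)) (toℕ-fromℕ< _)

interval-distinct : ∀ o (le : o + n ≤ m) → Distinct (interval o le)
interval-distinct o le i j e =
  toℕ-injective (+-cancelˡ-≡ o _ _ (trans (sym (interval-value o le i)) (trans (cong toℕ e) (interval-value o le j))))

-- For m ≥ 2n the words 0 … n-1 and n … 2n-1 are at distance at least n, so every
-- bound on the distances in G_m is at least n.
diameter-lower-bound : (Π : List (Vec (Fin n) n)) → n + n ≤ m → AllWithin Π m D → n ≤ D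
diameter-lower-bound {n = n} {m = m} Π 2n≤m all =
  walk-length-lower-bound low disjoint (all low high (interval-distinct 0 n≤m) (interval-distinct n 2n≤m))
  where
  n≤m : n ≤ m
  n≤m = ≤-trans (m≤m+n n n) 2n≤m
  low high : Vec (Fin m) n
  low  = interval 0 n≤m
  high = interval n 2n≤m
  open Presence Π high (interval-distinct n 2n≤m)
  disjoint : ∀ i → ¬ (lookup high i ∈ low)
  disjoint i p = <⇒≱ (toℕ<n j) (begin
      n                          ≤⟨ m≤m+n n (toℕ i) ⟩
      n + toℕ i                  ≡⟨ sym (interval-value n 2n≤m i) ⟩
      toℕ (lookup high i)        ≡⟨ cong toℕ (lookup-index p) ⟩
      toℕ (lookup low j)         ≡⟨ interval-value 0 n≤m j ⟩
      toℕ j                      ∎)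
    where
    open ≤-Reasoning
    j : Fin n
    j = VecAny.index p

map-distinct : (f : Fin m → Fin m′) (w : Vec (Fin m) n) →
  (∀ {x y} → x ∈ w → y ∈ w → f x ≡ f y → x ≡ y) → Distinct w → Distinct (map f w)
map-distinct f w f-inj w-distinct i j e =
  w-distinct i j (f-inj (∈-lookup i w) (∈-lookup j w) (trans (sym (lookup-map i f w)) (trans e (lookup-map j f w))))

map-fixes : ∀ {A : Set} (h : A → A) (w : Vec A n) → (∀ {x} → x ∈ w → h x ≡ x) → map h w ≡ w
map-fixes h []       _     = refl
map-fixes h (x ∷ xs) fixes = cong₂ _∷_ (fixes (here refl)) (map-fixes h xs (fixes ∘ there))

⟨$⟩ʳ-injective : ∀ (σ : Permutation′ m) {x y} → σ ⟨$⟩ʳ x ≡ σ ⟨$⟩ʳ y → x ≡ y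
⟨$⟩ʳ-injective σ = Injection.injective (↔⇒↣ σ)

transpose-left : ∀ (i j : Fin m) → transpose i j ⟨$⟩ʳ i ≡ j
transpose-left i j rewrite dec-true (i ≟ᶠ i) refl = refl

transpose-other : ∀ (i j k : Fin m) → k ≢ i → k ≢ j → transpose i j ⟨$⟩ʳ k ≡ k
transpose-other i j k k≢i k≢j rewrite dec-false (k ≟ᶠ i) k≢i | dec-false (k ≟ᶠ j) k≢j = refl

widen : ∀ {a l} b → a ≤ b + l → a < b + suc l
widen {l = l} b a≤b+l = ≤-trans (s≤s a≤b+l) (≤-reflexive (sym (+-suc b l)))

-- Induction on L: if the new
-- letter lands too high, swap it with the first free value b + |L|.
compress : ∀ (b : ℕ) (L : List (Fin m)) → ∃[ σ ]
  (∀ x → toℕ x < b → σ ⟨$⟩ʳ x ≡ x) × (∀ {x} → x ∈ₗ L → toℕ (σ ⟨$⟩ʳ x) < b + length L)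
compress b []      = idₚ , (λ _ _ → refl) , λ ()
compress {m} b (x ∷ L) with compress b L
... | σ , σ-fix , σ-bound with toℕ (σ ⟨$⟩ʳ x) ≤? b + length L
...   | yes σx≤c = σ , σ-fix , bound
  where
  bound : ∀ {z} → z ∈ₗ x ∷ L → toℕ (σ ⟨$⟩ʳ z) < b + suc (length L)
  bound (ListAny.here refl) = widen b σx≤c
  bound (ListAny.there z∈L) = widen b (<⇒≤ (σ-bound z∈L))
...   | no σx≰c = σ ∘ₚ transpose y t , fix , bound
  where
  c = b + length L
  y = σ ⟨$⟩ʳ x
  c<y : c < toℕ y
  c<y = ≰⇒> σx≰c
  t : Fin m
  t = fromℕ< (<-trans c<y (toℕ<n y))
  ≢y : ∀ {z} → toℕ z ≤ c → z ≢ y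
  ≢y z≤c z≡y = <⇒≱ c<y (≤-trans (≤-reflexive (cong toℕ (sym z≡y))) z≤c)
  ≢t : ∀ {z} → toℕ z < c → z ≢ t
  ≢t z<c z≡t = <⇒≢ z<c (trans (cong toℕ z≡t) (toℕ-fromℕ< _))
  fix : ∀ z → toℕ z < b → transpose y t ⟨$⟩ʳ (σ ⟨$⟩ʳ z) ≡ z
  fix z z<b rewrite σ-fix z z<b =
    transpose-other y t z (≢y (<⇒≤ z<c)) (≢t z<c)
    where z<c = ≤-trans z<b (m≤m+n b (length L))
  bound : ∀ {z} → z ∈ₗ x ∷ L → toℕ (transpose y t ⟨$⟩ʳ (σ ⟨$⟩ʳ z)) < b + suc (length L)
  bound (ListAny.here refl) rewrite transpose-left y t = widen b (≤-reflexive (toℕ-fromℕ< _))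
  bound {z} (ListAny.there z∈L) rewrite transpose-other y t (σ ⟨$⟩ʳ z) (≢y (<⇒≤ (σ-bound z∈L))) (≢t (σ-bound z∈L)) =
    widen b (<⇒≤ (σ-bound z∈L))

reinterpret : ∀ {a b} → Fin b → Fin a → Fin b
reinterpret {b = b} d x with toℕ x <? b
... | yes x<b = fromℕ< x<b
... | no _    = d

reinterpret-value : ∀ {a b} (d : Fin b) (x : Fin a) → toℕ x < b → toℕ (reinterpret d x) ≡ toℕ x
reinterpret-value {b = b} d x x<b with toℕ x <? b
... | yes _   = toℕ-fromℕ< _
... | no x≮b = ⊥-elim (x≮b x<b)

record Encoding (L : List (Fin K)) (m : ℕ) : Set where
  field
    encode           : Fin K → Fin m
    decode           : Fin m → Fin K
    encode-small     : ∀ {x} → x ∈ₗ L → toℕ (encode x) < length L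
    decode-encode    : ∀ {x} → x ∈ₗ L → decode (encode x) ≡ x
    decode-injective : ∀ {y y′} → toℕ y < K → toℕ y′ < K → decode y ≡ decode y′ → y ≡ y′

  encode-injective : ∀ {x y} → x ∈ₗ L → y ∈ₗ L → encode x ≡ encode y → x ≡ y
  encode-injective x∈L y∈L e = trans (sym (decode-encode x∈L)) (trans (cong decode e) (decode-encode y∈L))

encoding : (L : List (Fin K)) → length L ≤ m → Fin m → Fin K → Encoding L m
encoding {K} {m} L |L|≤m d d′ = record
  { encode           = encode
  ; decode           = decode
  ; encode-small     = λ x∈L → subst (_< length L) (sym (encode-value x∈L)) (τ-small x∈L)
  ; decode-encode    = λ {x} x∈L → trans
      (cong (τ ⟨$⟩ˡ_) (toℕ-injective (trans (reinterpret-value d′ _ (subst (_< K) (sym (encode-value x∈L)) (toℕ<n _)))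
                                            (encode-value x∈L))))
      (inverseˡ τ)
  ; decode-injective = λ y<K y′<K e → toℕ-injective (trans (sym (reinterpret-value d′ _ y<K))
      (trans (cong toℕ (⟨$⟩ʳ-injective (flip τ) e)) (reinterpret-value d′ _ y′<K)))
  }
  where
  τ : Permutation′ K
  τ = proj₁ (compress 0 L)
  τ-small : ∀ {x} → x ∈ₗ L → toℕ (τ ⟨$⟩ʳ x) < length L
  τ-small = proj₂ (proj₂ (compress 0 L))
  encode : Fin K → Fin m
  encode x = reinterpret d (τ ⟨$⟩ʳ x)
  decode : Fin m → Fin K
  decode y = τ ⟨$⟩ˡ reinterpret d′ y
  encode-value : ∀ {x} → x ∈ₗ L → toℕ (encode x) ≡ toℕ (τ ⟨$⟩ʳ x)
  encode-value x∈L = reinterpret-value d _ (≤-trans (τ-small x∈L) |L|≤m)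

-- Connectivity within k steps does not depend on the alphabet once it is large: a walk
-- of length ≤ k only involves the ≤ 2n letters of its ends and the ≤ k letters it
-- inserts.  To join u, v over Fin K, encode their letters below 2n in Fin m, take a walk
-- W there, move the letters inserted by W below 2n + k ≤ K by a permutation σ fixing the
-- values below 2n, and decode.
transfer : (Π : List (Vec (Fin n) n)) → 1 ≤ n → n + n ≤ m → n + n + k ≤ K →
  AllWithin Π m k → AllWithin Π K k
transfer {n} {m} {k} {K} Π 1≤n 2n≤m 2n+k≤K all u v u-distinct v-distinct =
  subst₂ (Walk≤ Π k) (round-trip u ∈-endsˡ) (round-trip v ∈-endsʳ)
         (relabel Π ψ Small (λ x-small y-small → ⟨$⟩ʳ-injective σ ∘ decode-injective x-small y-small)
                  W encoded-small inserted-small)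
  where
  2n≤K : n + n ≤ K
  2n≤K = ≤-trans (m≤m+n (n + n) k) 2n+k≤K
  ends : List (Fin K)
  ends = toList (u ++ v)
  ∈-endsˡ : ∀ {x} → x ∈ u → x ∈ₗ ends
  ∈-endsˡ = ∈-toList⁺ ∘ ∈-++⁺ˡ
  ∈-endsʳ : ∀ {x} → x ∈ v → x ∈ₗ ends
  ∈-endsʳ = ∈-toList⁺ ∘ ∈-++⁺ʳ u
  |ends|≡2n : length ends ≡ n + n
  |ends|≡2n = length-toList (u ++ v)
  open Encoding (encoding ends (subst (_≤ m) (sym |ends|≡2n) 2n≤m)
                          (fromℕ< (≤-trans 1≤n (≤-trans (m≤m+n n n) 2n≤m)))
                          (fromℕ< (≤-trans 1≤n (≤-trans (m≤m+n n n) 2n≤K))))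
  W : Walk≤ Π k (map encode u) (map encode v)
  W = all (map encode u) (map encode v)
          (map-distinct encode u (λ x∈u y∈u → encode-injective (∈-endsˡ x∈u) (∈-endsˡ y∈u)) u-distinct)
          (map-distinct encode v (λ x∈v y∈v → encode-injective (∈-endsʳ x∈v) (∈-endsʳ y∈v)) v-distinct)
  σ : Permutation′ m
  σ = proj₁ (compress (n + n) (inserted W))
  σ-fixes : ∀ y → toℕ y < n + n → σ ⟨$⟩ʳ y ≡ y
  σ-fixes = proj₁ (proj₂ (compress (n + n) (inserted W)))
  σ-packs : ∀ {y} → y ∈ₗ inserted W → toℕ (σ ⟨$⟩ʳ y) < n + n + length (inserted W)
  σ-packs = proj₂ (proj₂ (compress (n + n) (inserted W)))
  encoded-below-2n : ∀ {x} → x ∈ₗ ends → toℕ (encode x) < n + n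
  encoded-below-2n {x} x∈ends = subst (toℕ (encode x) <_) |ends|≡2n (encode-small x∈ends)
  σ-fixes-encoded : ∀ {x} → x ∈ₗ ends → σ ⟨$⟩ʳ encode x ≡ encode x
  σ-fixes-encoded x∈ends = σ-fixes _ (encoded-below-2n x∈ends)
  Small : Fin m → Set
  Small y = toℕ (σ ⟨$⟩ʳ y) < K
  ψ : Fin m → Fin K
  ψ = decode ∘ (σ ⟨$⟩ʳ_)
  encoded-small : ∀ {y} → y ∈ map encode u → Small y
  encoded-small y∈ with ∈-map⁻ encode u y∈
  ... | x , x∈u , refl = subst (λ z → toℕ z < K) (sym (σ-fixes-encoded (∈-endsˡ x∈u)))
                           (≤-trans (encoded-below-2n (∈-endsˡ x∈u)) 2n≤K)
  inserted-small : ∀ {y} → y ∈ₗ inserted W → Small y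
  inserted-small y∈ = ≤-trans (σ-packs y∈) (≤-trans (+-monoʳ-≤ (n + n) (inserted-length W)) 2n+k≤K)
  round-trip : (w : Vec (Fin K) n) → (∀ {x} → x ∈ w → x ∈ₗ ends) → map ψ (map encode w) ≡ w
  round-trip w w⊆ends = trans (sym (map-∘ ψ encode w)) (map-fixes (ψ ∘ encode) w λ x∈w →
    trans (cong decode (σ-fixes-encoded (w⊆ends x∈w))) (decode-encode (w⊆ends x∈w)))

diameter-is-n : (Π : List (Vec (Fin n) n)) → 1 ≤ n → n + n + n ≤ m → n + n + n ≤ K →
  AllWithin Π m n → IsDiameter Π K n
diameter-is-n {n} Π 1≤n 3n≤m 3n≤K all =
  transfer Π 1≤n (≤-trans (m≤m+n (n + n) n) 3n≤m) 3n≤K all ,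
  λ _ → diameter-lower-bound Π (≤-trans (m≤m+n (n + n) n) 3n≤K)

-- Bernoulli-type estimate (x + c)^n · (x − nc) ≤ x^(n+1), with e standing for x − nc.
bernoulli : ∀ n c x e → e + n * c ≤ x → (x + c) ^ n * e ≤ x ^ suc n
bernoulli zero c x e e≤x = begin
  1 * e     ≡⟨ *-identityˡ e ⟩
  e         ≤⟨ ≤-trans (m≤m+n e 0) e≤x ⟩
  x         ≡⟨ sym (*-identityʳ x) ⟩
  x * 1     ∎
  where open ≤-Reasoning
bernoulli (suc n) c x e e+[1+n]c≤x = begin
  (x + c) * (x + c) ^ n * e       ≡⟨ solve 3 (λ a b q → (a :* b) :* q := b :* (a :* q)) refl (x + c) ((x + c) ^ n) e ⟩
  (x + c) ^ n * ((x + c) * e)     ≤⟨ *-monoʳ-≤ ((x + c) ^ n) one-factor ⟩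
  (x + c) ^ n * (x * (e + c))     ≡⟨ solve 3 (λ a b q → a :* (b :* q) := b :* (a :* q)) refl ((x + c) ^ n) x (e + c) ⟩
  x * ((x + c) ^ n * (e + c))     ≤⟨ *-monoʳ-≤ x (bernoulli n c x (e + c) (≤-trans (≤-reflexive (+-assoc e c (n * c))) e+[1+n]c≤x)) ⟩
  x * x ^ suc n                   ∎
  where
  open ≤-Reasoning
  -- (x + c) e ≤ x (e + c) because e ≤ x.
  one-factor : (x + c) * e ≤ x * (e + c)
  one-factor = begin
    (x + c) * e      ≡⟨ *-distribʳ-+ e x c ⟩
    x * e + c * e    ≤⟨ +-monoʳ-≤ (x * e) (≤-trans (≤-reflexive (*-comm c e)) (*-monoˡ-≤ c (≤-trans (m≤m+n e _) e+[1+n]c≤x))) ⟩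
    x * e + x * c    ≡⟨ sym (*-distribˡ-+ x e c) ⟩
    x * (e + c)      ∎

power-ratio : ∀ K n c x → suc K * (n * c) < x → K * (x + c) ^ n < suc K * x ^ n
power-ratio K n c x large = *-cancelʳ-< e (K * (x + c) ^ n) (suc K * x ^ n) (begin-strict
  K * (x + c) ^ n * e                        ≡⟨ *-assoc K _ e ⟩
  K * ((x + c) ^ n * e)                      ≤⟨ *-monoʳ-≤ K (bernoulli n c x e (≤-reflexive e+nc≡x)) ⟩
  K * (x * x ^ n)                            ≡⟨ cong (λ z → K * (z * x ^ n)) (sym e+nc≡x) ⟩
  K * ((e + n * c) * x ^ n)                  ≡⟨ solve 4 (λ k a b X → k :* ((a :+ b) :* X) := k :* (a :* X) :+ X :* (k :* b)) refl K e (n * c) (x ^ n) ⟩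
  K * (e * x ^ n) + x ^ n * (K * (n * c))    <⟨ +-monoʳ-< (K * (e * x ^ n)) (*-monoʳ-< (x ^ n) {{xⁿ≢0}} Knc<e) ⟩
  K * (e * x ^ n) + x ^ n * e                ≡⟨ solve 3 (λ k a X → k :* (a :* X) :+ X :* a := (con 1 :+ k) :* X :* a) refl K e (x ^ n) ⟩
  suc K * x ^ n * e                          ∎)
  where
  open ≤-Reasoning
  e = x ∸ n * c
  e+nc≡x : e + n * c ≡ x
  e+nc≡x = m∸n+n≡m (≤-trans (m≤m+n (n * c) (K * (n * c))) (<⇒≤ large))
  Knc<e : K * (n * c) < e
  Knc<e = +-cancelʳ-< (n * c) (K * (n * c)) e (begin-strict
    K * (n * c) + n * c    ≡⟨ +-comm (K * (n * c)) (n * c) ⟩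
    suc K * (n * c)        <⟨ large ⟩
    x                      ≡⟨ sym e+nc≡x ⟩
    e + n * c              ∎)
  xⁿ≢0 : NonZero (x ^ n)
  xⁿ≢0 = >-nonZero (m^n>0 x {{>-nonZero (≤-trans (s≤s z≤n) large)}} n)

moore-lower : ∀ d D → d ^ D ≤ Moore d D
moore-lower d zero    = ≤-refl
moore-lower d (suc D) = m≤n+m (d ^ suc D) (suc (moorePred d D))

moore-upper : ∀ d D → Moore d D ≤ suc d ^ D
moore-upper d zero    = ≤-refl
moore-upper d (suc D) = begin
  Moore d D + d * d ^ D          ≤⟨ +-mono-≤ (moore-upper d D) (*-monoʳ-≤ d (^-monoˡ-≤ D (n≤1+n d))) ⟩
  suc d ^ D + d * suc d ^ D      ∎
  where open ≤-Reasoning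

P≡P′ : ∀ m n → n ≤ m → m P n ≡ m P′ n
P≡P′ m n n≤m with n ≤ᵇ m | ≤⇒≤ᵇ n≤m
... | true | _ = refl

P′-lower : ∀ m n → (m ∸ n) ^ n ≤ m P′ n
P′-lower m zero    = ≤-refl
P′-lower m (suc n) = *-mono-≤ (∸-monoʳ-≤ m (n≤1+n n)) (≤-trans (^-monoˡ-≤ n (∸-monoʳ-≤ m (n≤1+n n))) (P′-lower m n))

P′-upper : ∀ m n → m P′ n ≤ m ^ n
P′-upper m zero    = ≤-refl
P′-upper m (suc n) = *-mono-≤ (m∸n≤m m n) (P′-upper m n)

sandwich : ∀ {A B y z} K → z ≤ A → A ≤ y → z ≤ B → B ≤ y → K * y < suc K * z → dist A B * K < B
sandwich {A} {B} {y} {z} K z≤A A≤y z≤B B≤y ratio = ≤-trans (+-cancelʳ-< (z * K) (dist A B * K) z (begin-strict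
  dist A B * K + z * K       ≤⟨ +-monoˡ-≤ (z * K) (*-monoˡ-≤ K dist≤y∸z) ⟩
  (y ∸ z) * K + z * K        ≡⟨ sym (*-distribʳ-+ K (y ∸ z) z) ⟩
  (y ∸ z + z) * K            ≡⟨ cong (_* K) (m∸n+n≡m (≤-trans z≤A A≤y)) ⟩
  y * K                      ≡⟨ *-comm y K ⟩
  K * y                      <⟨ ratio ⟩
  z + K * z                  ≡⟨ cong (z +_) (*-comm K z) ⟩
  z + z * K                  ∎)) z≤B
  where
  open ≤-Reasoning
  dist≤y∸z : dist A B ≤ y ∸ z
  dist≤y∸z with ∣m-n∣≡[m∸n]∨[n∸m] A B
  ... | inj₁ e = ≤-trans (≤-reflexive e) (∸-mono A≤y z≤B)
  ... | inj₂ e = ≤-trans (≤-reflexive e) (∸-mono B≤y z≤A)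

half-gap : ∀ {A B} → A + A ≤ B → B ≤ dist A B * 2
half-gap {A} {B} 2A≤B = begin
  B                       ≡⟨ sym (m+[n∸m]≡n A≤B) ⟩
  A + (B ∸ A)             ≤⟨ +-monoˡ-≤ (B ∸ A) (m+n≤o⇒m≤o∸n A 2A≤B) ⟩
  (B ∸ A) + (B ∸ A)       ≡⟨ solve 1 (λ t → t :+ t := t :* con 2) refl (B ∸ A) ⟩
  (B ∸ A) * 2             ≡⟨ cong (_* 2) (sym (m≤n⇒∣m-n∣≡n∸m A≤B)) ⟩
  dist A B * 2            ∎
  where
  open ≤-Reasoning
  A≤B : A ≤ B
  A≤B = ≤-trans (m≤m+n A A) 2A≤B

-- Write x = m − n, d = p + x (p = |Π|), so that |V(G_m)| = m P n and d = d_m.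
-- Diameter n: the ratio |V(G_m)| / M(d, n) is within 1/K of 1 once x > (K + 1) n (n + p + 1),
-- since both numbers lie between x^n and (x + n + p + 1)^n.
moore-ratio-close : ∀ n p K m → n ≤ m → suc K * (n * (n + suc p)) < m ∸ n →
  dist (m P n) (Moore (p + (m ∸ n)) n) * K < Moore (p + (m ∸ n)) n
moore-ratio-close n p K m n≤m large =
  sandwich K lower-A upper-A lower-B upper-B (power-ratio K n c x large)
  where
  open ≤-Reasoning
  x = m ∸ n
  c = n + suc p
  d = p + x
  lower-A : x ^ n ≤ m P n
  lower-A = ≤-trans (P′-lower m n) (≤-reflexive (sym (P≡P′ m n n≤m)))
  upper-A : m P n ≤ (x + c) ^ n
  upper-A = begin
    m P n           ≡⟨ P≡P′ m n n≤m ⟩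
    m P′ n          ≤⟨ P′-upper m n ⟩
    m ^ n           ≡⟨ cong (_^ n) (sym (m∸n+n≡m n≤m)) ⟩
    (x + n) ^ n     ≤⟨ ^-monoˡ-≤ n (+-monoʳ-≤ x (m≤m+n n (suc p))) ⟩
    (x + c) ^ n     ∎
  lower-B : x ^ n ≤ Moore d n
  lower-B = ≤-trans (^-monoˡ-≤ n (m≤n+m x p)) (moore-lower d n)
  upper-B : Moore d n ≤ (x + c) ^ n
  upper-B = begin
    Moore d n           ≤⟨ moore-upper d n ⟩
    suc (p + x) ^ n     ≡⟨ cong (λ z → suc z ^ n) (+-comm p x) ⟩
    suc (x + p) ^ n     ≡⟨ cong (_^ n) (sym (+-suc x p)) ⟩
    (x + suc p) ^ n     ≤⟨ ^-monoˡ-≤ n (+-monoʳ-≤ x (m≤n+m (suc p) n)) ⟩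
    (x + c) ^ n         ∎

-- Diameter D > n: once x ≥ 4 and x > 2n², M(d, D) ≥ x^(n+1) ≥ 4 x^n > 2 (x + n)^n ≥ 2 |V(G_m)|,
-- so the ratio is at most 1/2.
moore-ratio-far : ∀ n p m D → n ≤ m → n < D → 4 + 2 * (n * n) ≤ m ∸ n →
  Moore (p + (m ∸ n)) D ≤ dist (m P n) (Moore (p + (m ∸ n)) D) * 2
moore-ratio-far n p m D n≤m n<D large = half-gap {m P n} (begin
  A + A                  ≤⟨ +-mono-≤ A≤Y A≤Y ⟩
  Y + Y                  <⟨ +-mono-< Y<2X Y<2X ⟩
  2 * X + 2 * X          ≡⟨ solve 1 (λ a → con 2 :* a :+ con 2 :* a := con 4 :* a) refl X ⟩
  4 * X                  ≤⟨ *-monoˡ-≤ X (≤-trans (m≤m+n 4 _) large) ⟩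
  x * X                  ≤⟨ ^-monoˡ-≤ (suc n) (m≤n+m x p) ⟩
  d ^ suc n              ≤⟨ ^-monoʳ-≤ d {{>-nonZero (≤-trans (s≤s z≤n) (≤-trans (m≤m+n 4 _) (≤-trans large (m≤n+m x p))))}} n<D ⟩
  d ^ D                  ≤⟨ moore-lower d D ⟩
  Moore d D              ∎)
  where
  open ≤-Reasoning
  x = m ∸ n
  d = p + x
  A = m P n
  X = x ^ n
  Y = (x + n) ^ n
  A≤Y : A ≤ Y
  A≤Y = begin
    m P n           ≡⟨ P≡P′ m n n≤m ⟩
    m P′ n          ≤⟨ P′-upper m n ⟩
    m ^ n           ≡⟨ cong (_^ n) (sym (m∸n+n≡m n≤m)) ⟩
    Y               ∎
  Y<2X : Y < 2 * X
  Y<2X = subst (_< 2 * X) (*-identityˡ Y) (power-ratio 1 n n x (≤-trans (s≤s (m≤n+m _ 3)) large))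

∣⊖∣≡dist : ∀ A B → ℤ.∣ A ⊖ B ∣ ≡ dist A B
∣⊖∣≡dist A B with ≤-total A B
... | inj₁ A≤B = trans (ℤ.∣⊖∣-≤ A≤B) (sym (m≤n⇒∣m-n∣≡n∸m A≤B))
... | inj₂ B≤A = trans (ℤ.∣m⊖n∣≡∣n⊖m∣ A B) (trans (ℤ.∣⊖∣-≤ B≤A) (sym (m≤n⇒∣n-m∣≡n∸m B≤A)))

distance-to-one : ∀ A b → toℚᵘ ∣ (ℤ.+ A) / suc b - 1ℚ ∣ ≃ mkℚᵘ (ℤ.+ dist A (suc b)) b
distance-to-one A b = ℚᵘ.≃-trans (toℚᵘ-homo-∣-∣ (r - 1ℚ))
  (ℚᵘ.≃-trans (ℚᵘ.∣-∣-cong (toℚᵘ-homo-+ r (ℚ.- 1ℚ)))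
  (ℚᵘ.≃-trans (ℚᵘ.∣-∣-cong (ℚᵘ.+-cong (toℚᵘ-fromℚᵘ (mkℚᵘ (ℤ.+ A) b)) (toℚᵘ-homo‿- 1ℚ)))
  unnormalised))
  where
  r = (ℤ.+ A) / suc b
  numerator : ℤ.+ A ℤ.* ℤ.+ 1 ℤ.+ (ℤ.- ℤ.+ 1) ℤ.* ℤ.+ suc b ≡ A ⊖ suc b
  numerator = trans (cong₂ ℤ._+_ (ℤ.*-identityʳ (ℤ.+ A)) (ℤ.-1*i≡-i (ℤ.+ suc b))) (ℤ.m-n≡m⊖n A (suc b))
  unnormalised : ℚᵘ.∣ mkℚᵘ (ℤ.+ A) b ℚᵘ.- ℚᵘ.1ℚᵘ ∣ ≃ mkℚᵘ (ℤ.+ dist A (suc b)) b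
  unnormalised = *≡* (cong₂ ℤ._*_ (cong ℤ.+_ (trans (cong ℤ.∣_∣ numerator) (∣⊖∣≡dist A (suc b))))
                                  (cong (λ k → ℤ.+ suc k) (sym (*-identityʳ b))))

close-to-one⁺ : ∀ A b (ε : ℚ) → 0ℚ <ℚ ε → dist A (suc b) * ↧ₙ ε < suc b → ∣ (ℤ.+ A) / suc b - 1ℚ ∣ <ℚ ε
close-to-one⁺ A b (mkℚ +[1+ k ] _ _) _ lt =
  toℚᵘ-cancel-< (ℚᵘ.<-respˡ-≃ (ℚᵘ.≃-sym (distance-to-one A b))
    (*<* (ℤ.+◃-mono-< (≤-trans lt (m≤m+n (suc b) (k * suc b))))))
close-to-one⁺ A b (mkℚ (ℤ.+ zero) _ _) (ℚ.*<* (ℤ.+<+ ()))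
close-to-one⁺ A b (mkℚ -[1+ _ ] _ _) (ℚ.*<* ())

close-to-one⁻ : ∀ A b (ε : ℚ) → 0ℚ <ℚ ε → ∣ (ℤ.+ A) / suc b - 1ℚ ∣ <ℚ ε → dist A (suc b) * ↧ₙ ε < ℤ.∣ ↥ ε ∣ * suc b
close-to-one⁻ A b (mkℚ +[1+ k ] _ _) _ lt with ℚᵘ.<-respˡ-≃ (distance-to-one A b) (toℚᵘ-mono-< lt)
... | *<* z = ℤ.+◃-cancel-< z
close-to-one⁻ A b (mkℚ (ℤ.+ zero) _ _) (ℚ.*<* (ℤ.+<+ ())) _
close-to-one⁻ A b (mkℚ -[1+ _ ] _ _) (ℚ.*<* ()) _

3n≤4n : ∀ n → n + n + n ≤ 4 * n
3n≤4n n = ≤-trans (m≤m+n (n + n + n) n) (≤-reflexive (solve 1 (λ a → a :+ a :+ a :+ a := con 4 :* a) refl n))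

eventually-close : (Π : List (Vec (Fin n) n)) → 1 ≤ n → AllWithin Π (4 * n) n → ∀ K → ∃[ N ] ∀ m → N ≤ m →
  IsDiameter Π m n × (dist (m P n) (Moore (outDeg Π m) n) * K < Moore (outDeg Π m) n)
eventually-close {n} Π 1≤n all4n K = T + n , λ m T+n≤m →
  diameter-is-n Π 1≤n (3n≤4n n) (≤-trans (m≤m+n (n + n + n) _) (≤-trans (m≤m+n T n) T+n≤m)) all4n ,
  moore-ratio-close n (length Π) K m (≤-trans (m≤n+m n T) T+n≤m)
                    (≤-trans (m≤n+m _ (n + n + n)) (m+n≤o⇒m≤o∸n T T+n≤m))
  where
  T : ℕ
  T = n + n + n + suc (suc K * (n * (n + suc (length Π))))

eventually-far : (Π : List (Vec (Fin n) n)) → ∃[ N ] ∀ m D → N ≤ m → n < D →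
  Moore (outDeg Π m) D ≤ dist (m P n) (Moore (outDeg Π m) D) * 2
eventually-far {n} Π = T + n , λ m D T+n≤m n<D →
  moore-ratio-far n (length Π) m D (≤-trans (m≤n+m n T) T+n≤m) n<D (m+n≤o⇒m≤o∸n T T+n≤m)
  where
  T : ℕ
  T = 4 + 2 * (n * n)

RatioTendsToOne : List (Vec (Fin n) n) → Set
RatioTendsToOne {n} Π = ∀ (ε : ℚ) → 0ℚ <ℚ ε → ∃[ N ] (∀ (m : ℕ) → N ≤ m → n < m →
  ∃[ D ] (IsDiameter Π m D × (∣ ratio Π m D - 1ℚ ∣ <ℚ ε)))

ratio-tends-to-one : (Π : List (Vec (Fin n) n)) → 1 ≤ n → IsDiameter Π (4 * n) n → RatioTendsToOne Π
ratio-tends-to-one {n} Π 1≤n (all4n , _) ε ε>0 = case eventually-close Π 1≤n all4n (↧ₙ ε) of λ where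
  (N , close) → N , λ m N≤m _ → n , proj₁ (close m N≤m) ,
    close-to-one⁺ (numVertices m n) (moorePred (outDeg Π m) n) ε ε>0 (proj₂ (close m N≤m))

-- Conversely, test the limit with ε = 1/2 at an m₀ beyond both thresholds: its diameter
-- D₀ cannot exceed n, so all distances in G_{m₀} are ≤ n, and transfer gives D_{4n} = n.
diameter-at-4n : (Π : List (Vec (Fin n) n)) → 1 ≤ n → RatioTendsToOne Π → IsDiameter Π (4 * n) n
diameter-at-4n {n} Π 1≤n limit = case limit ½ (positive⁻¹ ½) , eventually-far Π of λ where
  ((N₁ , close) , (N₂ , far)) →
    let m₀ = N₁ + N₂ + 4 * n
        4n≤m₀ : 4 * n ≤ m₀
        4n≤m₀ = m≤n+m (4 * n) (N₁ + N₂)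
        n<m₀ : n < m₀
        n<m₀ = <-≤-trans (m<m+n n 1≤n) (≤-trans (m≤m+n (n + n) n) (≤-trans (3n≤4n n) 4n≤m₀))
        (D₀ , D₀-diameter , D₀-close) = close m₀ (≤-trans (m≤m+n N₁ N₂) (m≤m+n _ (4 * n))) n<m₀
        D₀≤n : D₀ ≤ n
        D₀≤n = ≮⇒≥ λ n<D₀ → <⇒≱
          (close-to-one⁻ (numVertices m₀ n) (moorePred (outDeg Π m₀) D₀) ½ (positive⁻¹ ½) D₀-close)
          (≤-trans (≤-reflexive (*-identityˡ _)) (far m₀ D₀ (≤-trans (m≤n+m N₂ N₁) (m≤m+n _ (4 * n))) n<D₀))
    in diameter-is-n Π 1≤n (≤-trans (3n≤4n n) 4n≤m₀) (3n≤4n n)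
         (λ u v u-distinct v-distinct → walk-weaken D₀≤n (proj₁ D₀-diameter u v u-distinct v-distinct))

mainTheorem5 : (n : ℕ) → 1 ≤ n → (Π : List (Vec (Fin n) n)) → All IsPerm Π → Unique Π →
    ((∀ (ε : ℚ) → 0ℚ <ℚ ε → ∃[ N ] (∀ (m : ℕ) → N ≤ m → n < m →
        ∃[ D ] (IsDiameter Π m D × (∣ ratio Π m D - 1ℚ ∣ <ℚ ε))))
     ⇔ IsDiameter Π (4 * n) n)
mainTheorem5 n 1≤n Π _ _ = mk⇔ (diameter-at-4n Π 1≤n) (ratio-tends-to-one Π 1≤n)
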